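{- Let $G=\overline{B}(K_m,K_n)$ be a word-representable co-bipartite graph, and let $S$ be a semi-transitive orientation of $G$ in which the clique $K_m$ contains vertices of Type $A$, of Type $B$ and of Type $C$ (types taken with respect to $S$). Then there exists another semi-transitive orientation $S'$ of $G$ in which every vertex of $K_m$ is of Type $A$ or of Type $C$ (types taken with respect to $S'$).
   Context: A graph $G=(V,E)$ is word-representable if there is a word $w$ over the alphabet $V$ such that for distinct $x,y\in V$, the letters $x$ and $y$ alternate in $w$ (i.e. the subword of $w$ consisting only of $x$'s and $y$'s is of the form $xyxy\cdots$ or $yxyx\cdots$) if and only if $xy\in E$; every letter of $V$ must occur in $w$. A co-bipartite graph $\overline{B}(K_m,K_n)$ is a simple graph whose vertex set is the disjoint union of two sets $V(K_m)$ ($m$ vertices) and $V(K_n)$ ($n$ vertices), each inducing a clique, with an arbitrary set of edges between the two cliques. A semi-cycle is the digraph obtained from a directed cycle by reversing one edge; a shortcut is an acyclic digraph induced on the vertices of a semi-cycle containing a pair of non-adjacent vertices. An orientation of a graph is semi-transitive if it is acyclic and contains no shortcut as an induced subdigraph. In a semi-transitive orientation of $\overline{B}(K_m,K_n)$ the orientation restricted to each clique is transitive, hence a linear order, i.e. a directed Hamiltonian path $\vec P_1$ on $V(K_m)$ and $\vec P_2$ on $V(K_n)$. Types of a vertex $v\in V(K_m)$ with respect to such an orientation: $v$ is of Type $A$ if its neighbours in $K_n$ form a set of consecutive vertices of $\vec P_2$ and all edges between $v$ and these neighbours are oriented away from $v$; $v$ is of Type $B$ if its neighbours in $K_n$ form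 a set of consecutive vertices of $\vec P_2$ and all these edges are oriented towards $v$; $v$ is of Type $C$ if $\vec P_2$ can be split into three consecutive groups of vertices — an initial "source group" containing the source of $\vec P_2$, a possibly empty middle group, and a final "sink group" containing the sink of $\vec P_2$ — such that the neighbours of $v$ in $K_n$ are exactly the vertices of the source group and the sink group, every edge between $v$ and the source group is oriented towards $v$, and every edge between $v$ and the sink group is oriented away from $v$. -}

module Defs where

open import Data.Nat using (ℕ; zero; suc)
open import Data.Fin using (Fin; zero; suc; inject₁; fromℕ) renaming (_≟_ to _≟F_)
open import Data.Bool using (Bool; true; false; T)
open import Data.Sum using (_⊎_; inj₁; inj₂)
open import Data.Sum.Properties using (≡-dec)
open import Data.Product using (Σ; ∃; ∃-syntax; _×_; _,_)
open import Data.Empty using (⊥)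
open import Data.List using (List; filter)
open import Data.List.Membership.Propositional using (_∈_)
open import Data.List.Relation.Unary.Linked using (Linked)
open import Relation.Nullary using (¬_; Dec; yes; no)
open import Relation.Nullary.Decidable using (_⊎-dec_)
open import Relation.Binary.PropositionalEquality using (_≡_; _≢_)
open import Function.Bundles using (_⇔_)
open import Function.Definitions using (Injective)

-- Vertices: inj₁ i (i : Fin m) are the vertices of K_m,
--           inj₂ j (j : Fin n) are the vertices of K_n.
-- E i j = true  iff  the vertex i of K_m is adjacent to the vertex j of K_n.

Vtx : ℕ → ℕ → Set
Vtx m n = Fin m ⊎ Fin n

module CoBipartite {m n : ℕ} (E : Fin m → Fin n → Bool) where

  Adj : Vtx m n → Vtx m n → Set
  Adj (inj₁ i) (inj₁ j) = i ≢ j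
  Adj (inj₂ i) (inj₂ j) = i ≢ j
  Adj (inj₁ i) (inj₂ j) = T (E i j)
  Adj (inj₂ j) (inj₁ i) = T (E i j)

  _≟V_ : (x y : Vtx m n) → Dec (x ≡ y)
  _≟V_ = ≡-dec _≟F_ _≟F_

  restrict : Vtx m n → Vtx m n → List (Vtx m n) → List (Vtx m n)
  restrict x y = filter (λ z → (z ≟V x) ⊎-dec (z ≟V y))

  -- x and y alternate in w: the restricted subword has no two equal
  -- consecutive letters (i.e. it is xyxy... or yxyx...)
  Alternate : Vtx m n → Vtx m n → List (Vtx m n) → Set
  Alternate x y w = Linked _≢_ (restrict x y w)

  Represents : List (Vtx m n) → Set
  Represents w = (∀ x → x ∈ w) ×
                 (∀ x y → x ≢ y → (Alternate x y w ⇔ Adj x y))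

  WordRepresentable : Set
  WordRepresentable = ∃[ w ] Represents w

  Orientation : Set
  Orientation = Vtx m n → Vtx m n → Bool

  module _ (O : Orientation) where

    Arc : Vtx m n → Vtx m n → Set
    Arc x y = T (O x y)

    IsOrientation : Set
    IsOrientation = (∀ x y → Adj x y → Arc x y ⊎ Arc y x)
                  × (∀ x y → Arc x y → Adj x y)
                  × (∀ x y → Arc x y → ¬ Arc y x)

    data Walk⁺ : Vtx m n → Vtx m n → Set where
      [_]  : ∀ {x y} → Arc x y → Walk⁺ x y
      _∷_  : ∀ {x y z} → Arc x y → Walk⁺ y z → Walk⁺ x z

    Acyclic : Set
    Acyclic = ∀ x → ¬ Walk⁺ x x

    -- A semi-cycle on k+1 distinct vertices p 0, …, p k:
    -- directed path p 0 → p 1 → … → p k together with the arc p 0 → p k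
    -- (a directed cycle with one edge reversed).
    SemiCycle : (k : ℕ) → (Fin (suc k) → Vtx m n) → Set
    SemiCycle k p = Injective _≡_ _≡_ p
                  × (∀ (i : Fin k) → Arc (p (inject₁ i)) (p (suc i)))
                  × Arc (p zero) (p (fromℕ k))

    Shortcut : Set
    Shortcut = Σ ℕ λ k → Σ (Fin (suc k) → Vtx m n) λ p →
               SemiCycle k p ×
               (∃[ i ] ∃[ j ] (i ≢ j × ¬ Adj (p i) (p j)))

    SemiTransitive : Set
    SemiTransitive = IsOrientation × Acyclic × ¬ Shortcut

    -- Types of a vertex v of K_m.  The directed Hamiltonian path P₂ on K_n
    -- is the linear order given by the (transitive) orientation on K_n:
    -- u precedes w on P₂ iff Arc (inj₂ u) (inj₂ w).

    Before : Fin n → Fin n → Set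
    Before u w = Arc (inj₂ u) (inj₂ w)

    Consecutive : Fin m → Set
    Consecutive v = ∀ u z w → T (E v u) → T (E v w) →
                    Before u z → Before z w → T (E v z)

    TypeA : Fin m → Set
    TypeA v = Consecutive v × (∀ u → T (E v u) → Arc (inj₁ v) (inj₂ u))

    TypeB : Fin m → Set
    TypeB v = Consecutive v × (∀ u → T (E v u) → Arc (inj₂ u) (inj₁ v))

    -- s = last vertex of the source group, t = first vertex of the sink
    -- group; the middle group (strictly between s and t) may be empty.
    TypeC : Fin m → Set
    TypeC v = ∃[ s ] ∃[ t ] (Before s t ×
      (∀ u → (u ≡ s ⊎ Before u s) → T (E v u) × Arc (inj₂ u) (inj₁ v)) ×
      (∀ u → (u ≡ t ⊎ Before t u) → T (E v u) × Arc (inj₁ v) (inj₂ u)) ×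
      (∀ u → Before s u → Before u t → ¬ T (E v u)))

{-# OPTIONS --safe #-}
-- Let L be the set of vertices from which S has a directed path to an in-neighbour of a
-- vertex of K_m without out-neighbours in K_n.  L is closed under predecessors, so every arc
-- between L and its complement leaves L, and reversing exactly these arcs gives again a
-- semi-transitive orientation S′: a semi-cycle of S′ either stays on one side or, read from
-- the arc where it enters L, is a semi-cycle of S.  In S′ every vertex of K_m with an
-- in-neighbour in K_n also has an out-neighbour there: inside L it keeps an arc into L,
-- outside L it keeps its out-arcs of S, and if it has none, all its neighbours in K_n are
-- in L and it has no in-neighbour in S′.  By semi-transitivity a vertex of K_m without
-- in-neighbours in K_n is of Type A, and one with both in- and out-neighbours of Type C.
module Submission where

open import Defs
open import Data.Nat using (ℕ; zero; suc)
open import Data.Fin using (Fin; zero; suc; inject₁; fromℕ) renaming (_≟_ to _≟F_)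
open import Data.Fin.Properties using (any?; all?)
open import Data.Fin.Induction using (spo-noetherian)
open import Data.Bool using (Bool; T; if_then_else_; _xor_)
open import Data.Sum using (_⊎_; inj₁; inj₂)
import Data.Sum as Sum
open import Data.Product using (∃-syntax; ∃₂; _×_; _,_; proj₁; proj₂)
open import Data.Empty using (⊥-elim)
open import Data.List using (List; []; _∷_; _++_; length; lookup; tabulate)
open import Data.List.Membership.Propositional using (_∈_)
open import Data.List.Membership.Propositional.Properties using (∈-lookup; ∈-tabulate⁺)
open import Data.List.Relation.Unary.Any using (here; there; index)
open import Data.List.Relation.Unary.Any.Properties using (lookup-index)
import Data.List.Relation.Unary.All as All
open import Data.List.Relation.Unary.All using ([]; _∷_)
open import Data.List.Relation.Unary.AllPairs using ([]; _∷_)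
open import Data.List.Relation.Unary.Unique.Propositional using (Unique)
open import Data.List.Relation.Unary.Unique.Propositional.Properties using (tabulate⁺)
open import Data.List.Relation.Binary.Permutation.Propositional using (_↭_; ↭⇒↭ₛ)
open import Data.List.Relation.Binary.Permutation.Propositional.Properties using (++-comm; ∈-resp-↭)
import Data.List.Relation.Binary.Permutation.Setoid.Properties as SetoidPermutation
open import Function.Base using (_∘_; flip; case_of_)
open import Induction.WellFounded using (Acc; acc)
open import Relation.Binary.Core using (Rel)
open import Relation.Binary.Definitions using (Trichotomous; tri<; tri≈; tri>)
open import Relation.Binary.Structures using (IsStrictTotalOrder)
import Relation.Binary.Construct.Flip.EqAndOrd as Flip
open import Relation.Binary.PropositionalEquality
  using (_≡_; _≢_; refl; sym; cong; subst; subst₂; ≢-sym; resp₂; isEquivalence; setoid;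
         module ≡-Reasoning)
open import Relation.Nullary using (¬_; Dec; yes; no; ¬?; does)
open import Relation.Nullary.Decidable using (T?; _×-dec_; _⊎-dec_)
open import Relation.Unary using (Pred; Decidable)

module _ {n ℓ} {_<_ : Rel (Fin n) ℓ} (<-isStrictTotalOrder : IsStrictTotalOrder _≡_ _<_) where
  open IsStrictTotalOrder <-isStrictTotalOrder using (isStrictPartialOrder; _<?_)

  maximal : ∀ {p} {P : Pred (Fin n) p} → Decidable P → ∀ {a} → P a →
            ∃[ s ] P s × (∀ {u} → P u → ¬ s < u)
  maximal {P = P} P? = climb (spo-noetherian isStrictPartialOrder _)
    where
    climb : ∀ {a} → Acc (flip _<_) a → P a → ∃[ s ] P s × (∀ {u} → P u → ¬ s < u)
    climb {a} (acc above) pa with any? (λ u → P? u ×-dec a <? u)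
    ... | yes (u , pu , a<u) = climb (above a<u) pu
    ... | no nothing-above = a , pa , λ pu a<u → nothing-above (_ , pu , a<u)

module _ {a} {A : Set a} where

  lookup-injective : ∀ {xs : List A} → Unique xs → ∀ {i j} → lookup xs i ≡ lookup xs j → i ≡ j
  lookup-injective (_ ∷ _)     {zero}  {zero}  _ = refl
  lookup-injective (x∉xs ∷ _)  {zero}  {suc j} e = ⊥-elim (All.lookup x∉xs (∈-lookup j) e)
  lookup-injective (x∉xs ∷ _)  {suc i} {zero}  e = ⊥-elim (All.lookup x∉xs (∈-lookup i) (sym e))
  lookup-injective (_ ∷ uniq) {suc i} {suc j} e = cong suc (lookup-injective uniq e)

  Unique-resp-↭ : ∀ {xs ys : List A} → xs ↭ ys → Unique xs → Unique ys
  Unique-resp-↭ σ = SetoidPermutation.Unique-resp-↭ (setoid A) (↭⇒↭ₛ σ)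

pattern Kₘ i = inj₁ i
pattern Kₙ j = inj₂ j

module _ {m n : ℕ} (E : Fin m → Fin n → Bool) where
  open CoBipartite E

  private
    V : Set
    V = Vtx m n

  Adj? : ∀ u v → Dec (Adj u v)
  Adj? (Kₘ i) (Kₘ j) = ¬? (i ≟F j)
  Adj? (Kₘ i) (Kₙ j) = T? (E i j)
  Adj? (Kₙ j) (Kₘ i) = T? (E i j)
  Adj? (Kₙ i) (Kₙ j) = ¬? (i ≟F j)

  Adj-sym : ∀ {u v} → Adj u v → Adj v u
  Adj-sym {Kₘ _} {Kₘ _} = ≢-sym
  Adj-sym {Kₘ _} {Kₙ _} uv = uv
  Adj-sym {Kₙ _} {Kₘ _} uv = uv
  Adj-sym {Kₙ _} {Kₙ _} = ≢-sym

  infixr 5 _∷_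
  data Path (R : V → V → Set) : V → V → List V → Set where
    []  : ∀ {x} → Path R x x []
    _∷_ : ∀ {x y z ys} → R x y → Path R y z ys → Path R x z (y ∷ ys)

  module _ {R : V → V → Set} where

    _++⟨_⟩_ : ∀ {u w x z us ws} → Path R u z us → R z x → Path R x w ws → Path R u w (us ++ x ∷ ws)
    []      ++⟨ r ⟩ Q = r ∷ Q
    (s ∷ P) ++⟨ r ⟩ Q = s ∷ (P ++⟨ r ⟩ Q)

    tabulate-path : ∀ k (p : Fin (suc k) → V) → (∀ i → R (p (inject₁ i)) (p (suc i))) →
                    Path R (p zero) (p (fromℕ k)) (tabulate (p ∘ suc))
    tabulate-path zero    p steps = []
    tabulate-path (suc k) p steps = steps zero ∷ tabulate-path k (p ∘ suc) (steps ∘ suc)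

    path-step : ∀ {x z ys} → Path R x z ys →
                ∀ i → R (lookup (x ∷ ys) (inject₁ i)) (lookup (x ∷ ys) (suc i))
    path-step (r ∷ P) zero    = r
    path-step (r ∷ P) (suc i) = path-step P i

    path-end : ∀ {x z ys} → Path R x z ys → lookup (x ∷ ys) (fromℕ (length ys)) ≡ z
    path-end []      = refl
    path-end (_ ∷ P) = path-end P

  walk⇒path : ∀ {O x z} → Walk⁺ O x z → ∃₂ λ y ys → Path (Arc O) x z (y ∷ ys)
  walk⇒path [ a ]   = _ , _ , a ∷ []
  walk⇒path (a ∷ w) = let _ , _ , P = walk⇒path w in _ , _ , a ∷ P

  path⇒walk : ∀ {O x z y ys} → Path (Arc O) x z (y ∷ ys) → Walk⁺ O x z
  path⇒walk (a ∷ [])        = [ a ]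
  path⇒walk (a ∷ P@(_ ∷ _)) = a ∷ path⇒walk P

  NonAdjacentPairIn : List V → Set
  NonAdjacentPairIn vs = ∃₂ λ a b → a ∈ vs × b ∈ vs × a ≢ b × ¬ Adj a b

  NonAdjacentPairIn-resp-↭ : ∀ {us vs} → us ↭ vs → NonAdjacentPairIn us → NonAdjacentPairIn vs
  NonAdjacentPairIn-resp-↭ σ (a , b , a∈ , b∈ , a≢b , ¬ab) =
    a , b , ∈-resp-↭ σ a∈ , ∈-resp-↭ σ b∈ , a≢b , ¬ab

  -- Shortcuts with the vertex sequence as a list, so that a semi-cycle can be rotated.
  record ListShortcut (O : Orientation) : Set where
    constructor listShortcut
    field
      source sink  : V
      inner        : List V
      path         : Path (Arc O) source sink inner
      chord        : Arc O source sink
      distinct     : Unique (source ∷ inner)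
      nonAdjacent  : NonAdjacentPairIn (source ∷ inner)

  toListShortcut : ∀ {O} → Shortcut O → ListShortcut O
  toListShortcut (k , p , (p-injective , steps , chord) , i , j , i≢j , ¬adj) =
    listShortcut _ _ (tabulate (p ∘ suc)) (tabulate-path k p steps) chord (tabulate⁺ p-injective)
      (p i , p j , ∈-tabulate⁺ {f = p} i , ∈-tabulate⁺ {f = p} j , i≢j ∘ p-injective , ¬adj)

  fromListShortcut : ∀ {O} → ListShortcut O → Shortcut O
  fromListShortcut {O} (listShortcut x z ys P chord distinct (a , b , a∈ , b∈ , a≢b , ¬adj)) =
    length ys , lookup (x ∷ ys) ,
    (lookup-injective distinct , path-step P , subst (Arc O x) (sym (path-end P)) chord) ,
    index a∈ , index b∈ , a≢b ∘ same-index ,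
    subst₂ (λ c d → ¬ Adj c d) (lookup-index a∈) (lookup-index b∈) ¬adj
    where
    open ≡-Reasoning
    same-index : index a∈ ≡ index b∈ → a ≡ b
    same-index i≡j = begin
      a                          ≡⟨ lookup-index a∈ ⟩
      lookup (x ∷ ys) (index a∈) ≡⟨ cong (lookup (x ∷ ys)) i≡j ⟩
      lookup (x ∷ ys) (index b∈) ≡⟨ lookup-index b∈ ⟨
      b                          ∎

  module SemiTransitiveOrientation {O : Orientation} (st : SemiTransitive O) where

    infix 4 _⇒_
    _⇒_ : V → V → Set
    _⇒_ = Arc O

    orient : ∀ u v → Adj u v → u ⇒ v ⊎ v ⇒ u
    orient = proj₁ (proj₁ st)

    arc⇒adj : ∀ {u v} → u ⇒ v → Adj u v
    arc⇒adj = proj₁ (proj₂ (proj₁ st)) _ _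

    ⇒-asym : ∀ {u v} → u ⇒ v → ¬ v ⇒ u
    ⇒-asym = proj₂ (proj₂ (proj₁ st)) _ _

    acyclic : ∀ {u} → ¬ Walk⁺ O u u
    acyclic = proj₁ (proj₂ st) _

    shortcut-free : ¬ Shortcut O
    shortcut-free = proj₂ (proj₂ st)

    ⇒-irrefl : ∀ {u} → ¬ u ⇒ u
    ⇒-irrefl u⇒u = ⇒-asym u⇒u u⇒u

    ⇒-distinct : ∀ {u v} → u ⇒ v → u ≢ v
    ⇒-distinct uv refl = ⇒-irrefl uv

    ⇒-distinct₂ : ∀ {u v w} → u ⇒ v → v ⇒ w → u ≢ w
    ⇒-distinct₂ uv vw refl = ⇒-asym uv vw

    ⇒-trans-adj : ∀ {u v w} → u ⇒ v → v ⇒ w → Adj u w → u ⇒ w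
    ⇒-trans-adj {u} {v} {w} uv vw uw with orient u w uw
    ... | inj₁ u⇒w = u⇒w
    ... | inj₂ w⇒u = ⊥-elim (acyclic (uv ∷ (vw ∷ [ w⇒u ])))

    semiCycle₄⇒¬nonAdjacent : ∀ {u v w z} → u ⇒ v → v ⇒ w → w ⇒ z → u ⇒ z →
                              ¬ NonAdjacentPairIn (u ∷ v ∷ w ∷ z ∷ [])
    semiCycle₄⇒¬nonAdjacent uv vw wz uz pair =
      shortcut-free (fromListShortcut (listShortcut _ _ _ (uv ∷ vw ∷ wz ∷ []) uz distinct pair))
      where
      distinct : Unique (_ ∷ _ ∷ _ ∷ _ ∷ [])
      distinct = (⇒-distinct uv ∷ ⇒-distinct₂ uv vw ∷ ⇒-distinct uz ∷ [])
               ∷ (⇒-distinct vw ∷ ⇒-distinct₂ vw wz ∷ [])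
               ∷ (⇒-distinct wz ∷ [])
               ∷ [] ∷ []

    ⇒-trans₃ : ∀ {u v w z} → u ⇒ v → v ⇒ w → w ⇒ z → Adj u z → u ⇒ w × v ⇒ z
    ⇒-trans₃ {u} {v} {w} {z} uv vw wz uz with orient u z uz
    ... | inj₂ z⇒u = ⊥-elim (acyclic (uv ∷ (vw ∷ (wz ∷ [ z⇒u ]))))
    ... | inj₁ u⇒z with Adj? u w | Adj? v z
    ...   | yes adj-uw | yes adj-vz = ⇒-trans-adj uv vw adj-uw , ⇒-trans-adj vw wz adj-vz
    ...   | no ¬adj-uw | _          = ⊥-elim (semiCycle₄⇒¬nonAdjacent uv vw wz u⇒z
      (u , w , here refl , there (there (here refl)) , ⇒-distinct₂ uv vw , ¬adj-uw))
    ...   | yes _      | no ¬adj-vz = ⊥-elim (semiCycle₄⇒¬nonAdjacent uv vw wz u⇒z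
      (v , z , there (here refl) , there (there (there (here refl))) , ⇒-distinct₂ vw wz , ¬adj-vz))

    Kₘ-trans : ∀ {a c v} → Kₘ a ⇒ v → v ⇒ Kₘ c → Kₘ a ⇒ Kₘ c
    Kₘ-trans av vc = ⇒-trans-adj av vc (⇒-distinct₂ av vc ∘ cong inj₁)

    Kₙ-trans : ∀ {a c v} → Kₙ a ⇒ v → v ⇒ Kₙ c → Kₙ a ⇒ Kₙ c
    Kₙ-trans av vc = ⇒-trans-adj av vc (⇒-distinct₂ av vc ∘ cong inj₂)

    Kₘ-path₃ : ∀ {a c v w} → Kₘ a ⇒ v → v ⇒ w → w ⇒ Kₘ c → Kₘ a ⇒ w
    Kₘ-path₃ {a} {c} av vw wc with a ≟F c
    ... | yes refl = ⊥-elim (acyclic (av ∷ (vw ∷ [ wc ])))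
    ... | no a≢c   = proj₁ (⇒-trans₃ av vw wc a≢c)

    infix 4 _⇒⁼_
    _⇒⁼_ : V → V → Set
    u ⇒⁼ v = u ≡ v ⊎ u ⇒ v

    Kₘ-path₃ˡ : ∀ {a c v w} → Kₘ a ⇒⁼ v → v ⇒ w → w ⇒ Kₘ c → Kₘ a ⇒ w
    Kₘ-path₃ˡ (inj₁ refl) vw _  = vw
    Kₘ-path₃ˡ (inj₂ av)   vw wc = Kₘ-path₃ av vw wc

    Kₘ-path₃ʳ : ∀ {a c v w} → Kₘ a ⇒ v → v ⇒⁼ w → w ⇒ Kₘ c → Kₘ a ⇒ w
    Kₘ-path₃ʳ av (inj₁ refl) _  = av
    Kₘ-path₃ʳ av (inj₂ vw)   wc = Kₘ-path₃ av vw wc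

    Before-isStrictTotalOrder : IsStrictTotalOrder _≡_ (Before O)
    Before-isStrictTotalOrder = record
      { isStrictPartialOrder = record
        { isEquivalence = isEquivalence
        ; irrefl        = λ { refl → ⇒-irrefl }
        ; trans         = Kₙ-trans
        ; <-resp-≈      = resp₂ (Before O)
        }
      ; compare = compare
      }
      where
      compare : Trichotomous _≡_ (Before O)
      compare a b with a ≟F b
      ... | yes refl = tri≈ ⇒-irrefl refl ⇒-irrefl
      ... | no a≢b with orient (Kₙ a) (Kₙ b) a≢b
      ...   | inj₁ a<b = tri< a<b a≢b (⇒-asym a<b)
      ...   | inj₂ b<a = tri> (⇒-asym b<a) a≢b b<a

    no-in-neighbour⇒TypeA : ∀ {x} → (∀ y → ¬ Kₙ y ⇒ Kₘ x) → TypeA O x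
    no-in-neighbour⇒TypeA {x} no-in = consecutive , out
      where
      out : ∀ u → T (E x u) → Kₘ x ⇒ Kₙ u
      out u xu with orient (Kₘ x) (Kₙ u) xu
      ... | inj₁ x⇒u = x⇒u
      ... | inj₂ u⇒x = ⊥-elim (no-in u u⇒x)
      consecutive : Consecutive O x
      consecutive u z w xu xw u<z z<w =
        arc⇒adj (proj₁ (⇒-trans₃ (out u xu) u<z z<w (arc⇒adj (out w xw))))

    -- The source group ends at the last in-neighbour and the sink group starts at the first out-neighbour.
    in-and-out-neighbour⇒TypeC : ∀ {x y₁ y₂} → Kₙ y₁ ⇒ Kₘ x → Kₘ x ⇒ Kₙ y₂ → TypeC O x
    in-and-out-neighbour⇒TypeC {x} y₁x xy₂
      with maximal Before-isStrictTotalOrder (λ u → T? (O (Kₙ u) (Kₘ x))) y₁x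
         | maximal (Flip.isStrictTotalOrder Before-isStrictTotalOrder) (λ u → T? (O (Kₘ x) (Kₙ u))) xy₂
    ... | s , sx , s-last | t , xt , t-first =
      s , t , Kₙ-trans sx xt , source-group , sink-group , middle-group
      where
      source-group : ∀ u → (u ≡ s ⊎ Before O u s) → T (E x u) × Kₙ u ⇒ Kₘ x
      source-group _ (inj₁ refl) = arc⇒adj sx , sx
      source-group u (inj₂ u<s) = arc⇒adj ux , ux
        where ux = proj₁ (⇒-trans₃ u<s sx xt (arc⇒adj (Kₙ-trans u<s (Kₙ-trans sx xt))))

      sink-group : ∀ u → (u ≡ t ⊎ Before O t u) → T (E x u) × Kₘ x ⇒ Kₙ u
      sink-group _ (inj₁ refl) = arc⇒adj xt , xt
      sink-group u (inj₂ t<u) = arc⇒adj xu , xu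
        where xu = proj₂ (⇒-trans₃ sx xt t<u (arc⇒adj (Kₙ-trans (Kₙ-trans sx xt) t<u)))

      middle-group : ∀ u → Before O s u → Before O u t → ¬ T (E x u)
      middle-group u s<u u<t xu with orient (Kₘ x) (Kₙ u) xu
      ... | inj₁ x⇒u = t-first x⇒u u<t
      ... | inj₂ u⇒x = s-last u⇒x s<u

  module Reversal {O : Orientation} (st : SemiTransitive O)
                  {Lower : V → Set} (lower? : Decidable Lower)
                  (Lower-closed : ∀ {u v} → Arc O u v → Lower v → Lower u) where
    open SemiTransitiveOrientation st

    reversed : Orientation
    reversed u v = if does (lower? u) xor does (lower? v) then O v u else O u v

    infix 4 _⇒′_
    _⇒′_ : V → V → Set
    _⇒′_ = Arc reversed

    lower-step : ∀ {u v} → u ⇒′ v → Lower u → Lower v × u ⇒ v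
    lower-step {u} {v} uv lu with lower? u | lower? v
    ... | yes _   | yes lv  = lv , uv
    ... | yes _   | no ¬lv  = ⊥-elim (¬lv (Lower-closed uv lu))
    ... | no ¬lu  | _       = ⊥-elim (¬lu lu)

    upper-step : ∀ {u v} → u ⇒′ v → ¬ Lower u → ¬ Lower v → u ⇒ v
    upper-step {u} {v} uv ¬lu ¬lv with lower? u | lower? v
    ... | no _    | no _    = uv
    ... | yes lu  | _       = ⊥-elim (¬lu lu)
    ... | no _    | yes lv  = ⊥-elim (¬lv lv)

    crossing-step : ∀ {u v} → u ⇒′ v → ¬ Lower u → Lower v → v ⇒ u
    crossing-step {u} {v} uv ¬lu lv with lower? u | lower? v
    ... | no _    | yes _   = uv
    ... | yes lu  | _       = ⊥-elim (¬lu lu)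
    ... | no _    | no ¬lv  = ⊥-elim (¬lv lv)

    kept-within-Lower : ∀ {u v} → u ⇒ v → Lower v → u ⇒′ v
    kept-within-Lower {u} {v} uv lv with lower? u | lower? v
    ... | yes _   | yes _   = uv
    ... | _       | no ¬lv  = ⊥-elim (¬lv lv)
    ... | no ¬lu  | yes _   = ⊥-elim (¬lu (Lower-closed uv lv))

    kept-outside-Lower : ∀ {u v} → u ⇒ v → ¬ Lower u → u ⇒′ v
    kept-outside-Lower {u} {v} uv ¬lu with lower? u | lower? v
    ... | no _    | no _    = uv
    ... | yes lu  | _       = ⊥-elim (¬lu lu)
    ... | no _    | yes lv  = ⊥-elim (¬lu (Lower-closed uv lv))

    reversed-isOrientation : IsOrientation reversed
    reversed-isOrientation = orient′ , arc⇒adj′ , asym′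
      where
      orient′ : ∀ u v → Adj u v → u ⇒′ v ⊎ v ⇒′ u
      orient′ u v uv with lower? u | lower? v | orient u v uv
      ... | yes _ | yes _ | o = o
      ... | no _  | no _  | o = o
      ... | yes _ | no _  | o = Sum.swap o
      ... | no _  | yes _ | o = Sum.swap o

      arc⇒adj′ : ∀ u v → u ⇒′ v → Adj u v
      arc⇒adj′ u v uv with lower? u | lower? v
      ... | yes _ | yes _ = arc⇒adj uv
      ... | no _  | no _  = arc⇒adj uv
      ... | yes _ | no _  = Adj-sym {v} {u} (arc⇒adj uv)
      ... | no _  | yes _ = Adj-sym {v} {u} (arc⇒adj uv)

      asym′ : ∀ u v → u ⇒′ v → ¬ v ⇒′ u
      asym′ u v uv vu with lower? u | lower? v
      ... | yes _ | yes _ = ⇒-asym uv vu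
      ... | no _  | no _  = ⇒-asym uv vu
      ... | yes _ | no _  = ⇒-asym uv vu
      ... | no _  | yes _ = ⇒-asym uv vu

    lower-path : ∀ {u v vs} → Path _⇒′_ u v vs → Lower u → Lower v × Path _⇒_ u v vs
    lower-path []       lu = lu , []
    lower-path (uw ∷ P) lu =
      let lw , uw′ = lower-step uw lu
          lv , P′  = lower-path P lw
      in lv , uw′ ∷ P′

    upper-path : ∀ {u v vs} → Path _⇒′_ u v vs → ¬ Lower u → ¬ Lower v → Path _⇒_ u v vs
    upper-path []       _   _   = []
    upper-path (uw ∷ P) ¬lu ¬lv = upper-step uw ¬lu ¬lw ∷ upper-path P ¬lw ¬lv
      where ¬lw = λ lw → ¬lv (proj₁ (lower-path P lw))

    data Crossing (x z : V) : List V → Set where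
      crossing : ∀ {w v ws vs} → Path _⇒_ x w ws → v ⇒ w → Path _⇒_ v z vs → Crossing x z (ws ++ v ∷ vs)

    _∷ᶜ_ : ∀ {x y z ys} → x ⇒ y → Crossing y z ys → Crossing x z (y ∷ ys)
    xy ∷ᶜ crossing Pw vw Pv = crossing (xy ∷ Pw) vw Pv

    split-crossing : ∀ {x z ys} → Path _⇒′_ x z ys → ¬ Lower x → Lower z → Crossing x z ys
    split-crossing []                  ¬lx lz = ⊥-elim (¬lx lz)
    split-crossing (_∷_ {y = y} xy P) ¬lx lz = case lower? y of λ where
      (yes ly)  → crossing [] (crossing-step xy ¬lx ly) (proj₂ (lower-path P ly))
      (no ¬ly)  → upper-step xy ¬lx ¬ly ∷ᶜ split-crossing P ¬ly lz

    reversed-acyclic : Acyclic reversed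
    reversed-acyclic u cycle with walk⇒path cycle
    ... | _ , _ , P = case lower? u of λ where
      (yes lu)  → acyclic (path⇒walk (proj₂ (lower-path P lu)))
      (no ¬lu)  → acyclic (path⇒walk (upper-path P ¬lu ¬lu))

    -- Read from the arc that enters Lower, a crossing path closed by an arc leaving Lower
    -- is a semi-cycle on the same vertices.
    rotate : ∀ {x z ys} → Crossing x z ys → z ⇒ x →
             Unique (x ∷ ys) → NonAdjacentPairIn (x ∷ ys) → ListShortcut O
    rotate {x} (crossing {w} {v} {ws} {vs} Pw vw Pv) zx distinct pair =
      listShortcut v w (vs ++ x ∷ ws) (Pv ++⟨ zx ⟩ Pw) vw
        (Unique-resp-↭ rotation distinct) (NonAdjacentPairIn-resp-↭ rotation pair)
      where
      rotation : x ∷ ws ++ v ∷ vs ↭ v ∷ vs ++ x ∷ ws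
      rotation = ++-comm (x ∷ ws) (v ∷ vs)

    reversed-shortcut⇒shortcut : ListShortcut reversed → ListShortcut O
    reversed-shortcut⇒shortcut (listShortcut x z ys P xz distinct pair) = case lower? x , lower? z of λ where
      (yes lx  , _)       → listShortcut x z ys (proj₂ (lower-path P lx)) (proj₂ (lower-step xz lx))
                              distinct pair
      (no ¬lx  , no ¬lz)  → listShortcut x z ys (upper-path P ¬lx ¬lz) (upper-step xz ¬lx ¬lz)
                              distinct pair
      (no ¬lx  , yes lz)  → rotate (split-crossing P ¬lx lz) (crossing-step xz ¬lx lz) distinct pair

    reversed-semiTransitive : SemiTransitive reversed
    reversed-semiTransitive =
      reversed-isOrientation , reversed-acyclic ,
      shortcut-free ∘ fromListShortcut ∘ reversed-shortcut⇒shortcut ∘ toListShortcut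

  module Reorientation {S : Orientation} (st : SemiTransitive S) where
    open SemiTransitiveOrientation st

    NoOutNeighbour : Fin m → Set
    NoOutNeighbour b = ∀ y → ¬ Kₘ b ⇒ Kₙ y

    -- Lower is the set of vertices with a directed path to an in-neighbour of a vertex
    -- without out-neighbours; by Lower-closed, the two normal forms below describe all of it.
    LowerKₙ : Fin n → Set
    LowerKₙ y = ∃₂ λ b y′ → NoOutNeighbour b × Kₙ y′ ⇒ Kₘ b × Kₙ y ⇒⁼ Kₙ y′

    LowerKₘ : Fin m → Set
    LowerKₘ x = ∃₂ λ x′ y → Kₘ x ⇒⁼ Kₘ x′ × Kₘ x′ ⇒ Kₙ y × LowerKₙ y

    Lower : V → Set
    Lower (Kₘ x) = LowerKₘ x
    Lower (Kₙ y) = LowerKₙ y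

    _⇒⁼?_ : ∀ u v → Dec (u ⇒⁼ v)
    u ⇒⁼? v = (u ≟V v) ⊎-dec T? (S u v)

    LowerKₙ? : Decidable LowerKₙ
    LowerKₙ? y = any? λ b → any? λ y′ →
      all? (λ z → ¬? (T? (S (Kₘ b) (Kₙ z)))) ×-dec T? (S (Kₙ y′) (Kₘ b)) ×-dec
      Kₙ y ⇒⁼? Kₙ y′

    lower? : Decidable Lower
    lower? (Kₘ x) = any? λ x′ → any? λ y →
      Kₘ x ⇒⁼? Kₘ x′ ×-dec T? (S (Kₘ x′) (Kₙ y)) ×-dec LowerKₙ? y
    lower? (Kₙ y) = LowerKₙ? y

    LowerKₙ-closed : ∀ {u y} → Kₙ u ⇒ Kₙ y → LowerKₙ y → LowerKₙ u
    LowerKₙ-closed u<y (b , y′ , nb , y′b , inj₁ refl) = b , y′ , nb , y′b , inj₂ u<y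
    LowerKₙ-closed u<y (b , y′ , nb , y′b , inj₂ y<y′) = b , y′ , nb , y′b , inj₂ (Kₙ-trans u<y y<y′)

    Lower-closed : ∀ {u v} → u ⇒ v → Lower v → Lower u
    Lower-closed {Kₙ _} {Kₙ _} uv lv = LowerKₙ-closed uv lv
    Lower-closed {Kₘ u} {Kₙ v} uv lv = u , v , inj₁ refl , uv , lv
    Lower-closed {Kₘ _} {Kₘ _} uv (x′ , y , inj₁ refl , x′y , ly) = x′ , y , inj₂ uv , x′y , ly
    Lower-closed {Kₘ _} {Kₘ _} uv (x′ , y , inj₂ vx′ , x′y , ly) =
      x′ , y , inj₂ (Kₘ-trans uv vx′) , x′y , ly
    Lower-closed {Kₙ _} {Kₘ _} uv (x′ , y , inj₁ refl , x′y , ly) = LowerKₙ-closed (Kₙ-trans uv x′y) ly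
    Lower-closed {Kₙ u} {Kₘ _} uv (x′ , y , inj₂ vx′ , x′y , ly) with u ≟F y
    ... | yes refl = ly
    ... | no u≢y   = LowerKₙ-closed (Kₙ-trans (proj₁ (⇒-trans₃ uv vx′ x′y u≢y)) x′y) ly

    LowerKₘ⇒out-neighbour-in-LowerKₙ : ∀ {x} → LowerKₘ x → ∃[ y ] Kₘ x ⇒ Kₙ y × LowerKₙ y
    LowerKₘ⇒out-neighbour-in-LowerKₙ (x′ , y , x⇒⁼x′ , x′y , (b , y′ , nb , y′b , y⇒⁼y′)) =
      y′ , Kₘ-path₃ˡ x⇒⁼x′ (Kₘ-path₃ʳ x′y y⇒⁼y′ y′b) y′b , (b , y′ , nb , y′b , inj₁ refl)

    NoOutNeighbour⇒neighbours-LowerKₙ : ∀ {x y} → NoOutNeighbour x → Adj (Kₙ y) (Kₘ x) → LowerKₙ y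
    NoOutNeighbour⇒neighbours-LowerKₙ {x} {y} nx adj with orient (Kₙ y) (Kₘ x) adj
    ... | inj₁ yx = x , y , nx , yx , inj₁ refl
    ... | inj₂ xy = ⊥-elim (nx y xy)

    open Reversal st lower? Lower-closed public

    module S′ = SemiTransitiveOrientation reversed-semiTransitive

    in-neighbour′⇒out-neighbour′ : ∀ {x y₁} → Kₙ y₁ ⇒′ Kₘ x → ∃[ y ] Kₘ x ⇒′ Kₙ y
    in-neighbour′⇒out-neighbour′ {x} y₁x =
      case lower? (Kₘ x) , any? (λ z → T? (S (Kₘ x) (Kₙ z))) of λ where
        (yes lx  , _)            → let y , xy , ly = LowerKₘ⇒out-neighbour-in-LowerKₙ lx
                                   in y , kept-within-Lower xy ly
        (no ¬lx  , yes (z , xz)) → z , kept-outside-Lower xz ¬lx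
        (no ¬lx  , no no-out)    → ⊥-elim (¬lx (proj₁ (lower-step y₁x
          (NoOutNeighbour⇒neighbours-LowerKₙ (λ z xz → no-out (z , xz)) (S′.arc⇒adj y₁x)))))

    TypeA-or-TypeC : ∀ x → TypeA reversed x ⊎ TypeC reversed x
    TypeA-or-TypeC x with any? (λ y → T? (reversed (Kₙ y) (Kₘ x)))
    ... | no no-in      = inj₁ (S′.no-in-neighbour⇒TypeA (λ y yx → no-in (y , yx)))
    ... | yes (y₁ , y₁x) =
      inj₂ (S′.in-and-out-neighbour⇒TypeC y₁x (proj₂ (in-neighbour′⇒out-neighbour′ y₁x)))

mainTheorem1 : ∀ {m n : ℕ} (E : Fin m → Fin n → Bool) →
    CoBipartite.WordRepresentable E →
    (S : CoBipartite.Orientation E) → CoBipartite.SemiTransitive E S →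
    (∃[ a ] CoBipartite.TypeA E S a) →
    (∃[ b ] CoBipartite.TypeB E S b) →
    (∃[ c ] CoBipartite.TypeC E S c) →
    ∃[ S′ ] (CoBipartite.SemiTransitive E S′ ×
      (∀ v → CoBipartite.TypeA E S′ v ⊎ CoBipartite.TypeC E S′ v))
mainTheorem1 E _ S st _ _ _ = reversed , reversed-semiTransitive , TypeA-or-TypeC
  where open Reorientation E st
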